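{- Let $\mathbf{X}$ be an effectively locally compact represented space and let $Y\in\mathcal{O}(\mathbf{X})$ be computable. Then the subspace $\mathbf{Y}$ of $\mathbf{X}$ is effectively locally compact.
   Context: A represented space $\mathbf{X}=(X,\delta_X)$ is a set with a partial surjection $\delta_X:\subseteq\mathbb{N}^\mathbb{N}\to X$; computability of (partial, multi-valued) maps means having computable realizers; a subspace $\mathbf{Y}$ carries the representation $\delta_X$ restricted to $\delta_X^{ -1}(Y)$. $\mathbb{S}=\{\top,\bot\}$ is Sierpiński space ($p$ names $\top$ iff $p$ has a nonzero entry). $\mathcal{O}(\mathbf{X})$: open subsets, identified with characteristic maps $\mathbf{X}\to\mathbb{S}$. $\mathcal{K}(\mathbf{X})$: compact subsets $K$ represented by the map $\mathcal{O}(\mathbf{X})\to\mathbb{S}$, $U\mapsto\top$ iff $K\subseteq U$. A represented space $\mathbf{X}$ is effectively locally compact if the multi-valued map $\mathrm{CompactBase}:\subseteq\mathbf{X}\times\mathcal{O}(\mathbf{X})\rightrightarrows\mathcal{O}(\mathbf{X})\times\mathcal{K}(\mathbf{X})$ with domain $\{(x,U)\mid x\in U\}$ and $(V,K)\in\mathrm{CompactBase}(x,U)$ iff $x\in V\subseteq K\subseteq U$ is computable. -}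

module Defs where

open import Data.Nat using (ℕ; zero; suc; _+_; _<_)
open import Data.Fin using (Fin)
open import Data.Vec using (Vec; []; _∷_; lookup)
open import Data.List using (List; []; _∷_; _++_; [_])
open import Data.Bool using (Bool; true; false; T)
open import Data.Product using (Σ; _×_; _,_; ∃)
open import Relation.Binary.PropositionalEquality using (_≡_; _≢_; refl; cong)
open import Function.Bundles using (_⇔_)

Baire : Set
Baire = ℕ → ℕ

tri : ℕ → ℕ
tri zero = zero
tri (suc k) = suc k + tri k

pair : ℕ → ℕ → ℕ
pair n m = tri (n + m) + m

code : List ℕ → ℕ
code [] = zero
code (x ∷ xs) = suc (pair x (code xs))

prefix : Baire → ℕ → List ℕ
prefix p zero = []
prefix p (suc k) = prefix p k ++ [ p k ]

-- interleaving <p,q>(2n) = p n , <p,q>(2n+1) = q n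
join : Baire → Baire → Baire
join p q zero = p zero
join p q (suc zero) = q zero
join p q (suc (suc n)) = join (λ i → p (suc i)) (λ i → q (suc i)) n

evens : Baire → Baire
evens r n = r (n + n)

odds : Baire → Baire
odds r n = r (suc (n + n))

data PR : ℕ → Set where
  Z : ∀ {n} → PR n
  S : PR 1
  P : ∀ {n} → Fin n → PR n
  C : ∀ {m n} → PR m → Vec (PR n) m → PR n
  R : ∀ {n} → PR n → PR (suc (suc n)) → PR (suc n)
  M : ∀ {n} → PR (suc n) → PR n

mutual
  data Eval : ∀ {n} → PR n → Vec ℕ n → ℕ → Set where
    eZ : ∀ {n} {xs : Vec ℕ n} → Eval Z xs 0
    eS : ∀ {x} → Eval S (x ∷ []) (suc x)
    eP : ∀ {n} {i : Fin n} {xs} → Eval (P i) xs (lookup xs i)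
    eC : ∀ {m n} {f : PR m} {gs : Vec (PR n) m} {xs ys y} →
         EvalV gs xs ys → Eval f ys y → Eval (C f gs) xs y
    eR0 : ∀ {n} {f : PR n} {g} {xs y} → Eval f xs y → Eval (R f g) (0 ∷ xs) y
    eRs : ∀ {n} {f : PR n} {g} {xs k z y} →
          Eval (R f g) (k ∷ xs) z → Eval g (k ∷ z ∷ xs) y → Eval (R f g) (suc k ∷ xs) y
    eM : ∀ {n} {f : PR (suc n)} {xs k} →
         Eval f (k ∷ xs) 0 →
         (∀ j → j < k → Σ ℕ λ m → Eval f (j ∷ xs) (suc m)) →
         Eval (M f) xs k

  data EvalV : ∀ {m n} → Vec (PR n) m → Vec ℕ n → Vec ℕ m → Set where
    [] : ∀ {n} {xs : Vec ℕ n} → EvalV [] xs []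
    _∷_ : ∀ {m n} {g : PR n} {gs : Vec (PR n) m} {xs y ys} →
          Eval g xs y → EvalV gs xs ys → EvalV (g ∷ gs) xs (y ∷ ys)

Computable : Baire → Set
Computable q = Σ (PR 1) λ c → ∀ n → Eval c (n ∷ []) (q n)

-- Kleene associates: the partial continuous map F_q on Baire space coded by q.
-- F_q(p)(n) = m  iff  for the least k with q<n, p[k]> ≠ 0 we have q<n,p[k]> = m+1.

AssocOut : Baire → Baire → ℕ → ℕ → Set
AssocOut q p n m =
  Σ ℕ λ k → (q (pair n (code (prefix p k))) ≡ suc m)
          × (∀ j → j < k → q (pair n (code (prefix p j))) ≡ 0)

Assoc : Baire → Baire → Baire → Set
Assoc q p r = ∀ n → AssocOut q p n (r n)

-- Sierpinski space: Bool with true = ⊤, false = ⊥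

SName : Baire → Bool → Set
SName r true = Σ ℕ λ n → r n ≢ 0
SName r false = ∀ n → r n ≡ 0

-- Represented spaces (δ a partial surjection, given as a functional relation)

record Rep : Set₁ where
  field
    Carrier : Set
    δ : Baire → Carrier → Set
    δ-functional : ∀ {p x y} → δ p x → δ p y → x ≡ y
    δ-surjective : ∀ x → Σ Baire λ p → δ p x

open Rep public

private
  T-irr : ∀ {b} (u v : T b) → u ≡ v
  T-irr {true} _ _ = refl

  Σ-T-≡ : ∀ {A : Set} {Y : A → Bool} {x y : A} {u : T (Y x)} {v : T (Y y)} →
          x ≡ y → _≡_ {A = Σ A (λ a → T (Y a))} (x , u) (y , v)
  Σ-T-≡ {u = u} {v} refl = cong (_ ,_) (T-irr u v)

-- the subspace of X on the set Y ⊆ X (Y given by its characteristic map X → 𝕊)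
Sub : (X : Rep) → (Carrier X → Bool) → Rep
Sub X Y = record
  { Carrier = Σ (Carrier X) λ x → T (Y x)
  ; δ = λ p xy → δ X p (Data.Product.proj₁ xy)
  ; δ-functional = λ a b → Σ-T-≡ (δ-functional X a b)
  ; δ-surjective = λ { (x , u) → let (p , d) = δ-surjective X x in p , d }
  }

module _ (X : Rep) where
  private
    A = Carrier X

  -- q names the open set U (characteristic map χ_U : X → 𝕊):
  -- F_q is a realizer of χ_U
  NameO : Baire → (A → Bool) → Set
  NameO q U = ∀ p x → δ X p x → Σ Baire λ r → Assoc q p r × SName r (U x)

  -- q names the compact set K: F_q realizes U ↦ (⊤ iff K ⊆ U) on 𝒪(X)
  NameK : Baire → (A → Set) → Set
  NameK q K = ∀ p U → NameO p U →
    Σ Baire λ r → Assoc q p r ×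
      Σ Bool λ b → SName r b × (T b ⇔ (∀ x → K x → T (U x)))

  -- CompactBase has a computable realizer
  EffLocCompact : Set₁
  EffLocCompact =
    Σ Baire λ q → Computable q ×
      (∀ p₁ p₂ x U → δ X p₁ x → NameO p₂ U → T (U x) →
        Σ Baire λ r → Assoc q (join p₁ p₂) r ×
          Σ (A → Bool) λ V → Σ (A → Set) λ K →
            NameO (evens r) V × NameK (odds r) K ×
            T (V x) × (∀ y → T (V y) → K y) × (∀ y → K y → T (U y)))

  ComputableOpen : (A → Bool) → Set
  ComputableOpen U = Σ Baire λ q → Computable q × NameO q U

-- Let qX be a computable associate of a CompactBase realizer of X and qY a
-- computable name of the open Y.  A name of a point of the subspace Y is a
-- name of it in X, and a name d of an open U of the subspace is turned into
-- the name restrict d of the open lift U = {x | x ∈ Y ∧ (x , _) ∈ U} of X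
-- by running qY and d side by side (restrict-names).  On join p (restrict d)
-- the realizer qX outputs r naming V and K with x ∈ V ⊆ K ⊆ lift U; then
-- evens r names V ∩ Y in the subspace (open-name), and precomposing odds r
-- with restrict names K as a compact subset of the subspace (compact-name).
-- It remains to see that join p d ↦ r′ has a computable associate qSub: it
-- simulates qX on the prefix of join p (restrict d) that a prefix of
-- join p d determines (Construction), its stages converge to r′ because
-- that prefix grows without bound (Simulation), and every step is
-- assembled from μ-recursive programs (ConstructionComputable).

module Submission where

open import Defs
open import Data.Bool using (Bool; true; false; T)
open import Data.Unit using (tt)
open import Data.Empty using (⊥-elim)
open import Data.Nat using (ℕ; zero; suc; _+_; _∸_; _<_; _≤_; z≤n; s≤s; pred; _≤?_; _<?_; _⊔_; _⊓_)
open import Data.Nat.Properties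
open import Data.Fin using (Fin; #_; _↑ʳ_)
open import Data.Vec using (Vec; []; _∷_; lookup; tabulate; _++_; map)
open import Data.Vec.Properties using (tabulate-cong; tabulate∘lookup; tabulate-∘; lookup-++ʳ)
open import Data.List using ([]; _∷_)
open import Data.Product using (Σ; _×_; _,_; proj₁; proj₂)
open import Data.Sum using (_⊎_; inj₁; inj₂)
open import Function.Bundles using (mk⇔; Equivalence)
open import Relation.Nullary using (yes; no)
open import Relation.Binary.Definitions using (tri<; tri≈; tri>)
open import Relation.Binary.PropositionalEquality

Fn : ℕ → Set
Fn n = Vec ℕ n → ℕ

CFun : ℕ → Set
CFun n = Σ (Fn n) λ f → Σ (PR n) λ c → ∀ xs → Eval c xs (f xs)

⟦_⟧ : ∀ {n} → CFun n → Fn n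
⟦ f ⟧ = proj₁ f

app : ∀ {m n} → CFun m → Vec (CFun n) m → CFun n
app {n = n} (f , c , e) gs =
  (λ xs → f (map (λ g → ⟦ g ⟧ xs) gs)) , C c (map (λ g → proj₁ (proj₂ g)) gs) ,
  λ xs → eC (evals gs xs) (e _)
  where
  evals : ∀ {k} (gs : Vec (CFun n) k) xs →
          EvalV (map (λ g → proj₁ (proj₂ g)) gs) xs (map (λ g → ⟦ g ⟧ xs) gs)
  evals [] xs = []
  evals (g ∷ gs) xs = proj₂ (proj₂ g) xs ∷ evals gs xs

var : ∀ {n} → Fin n → CFun n
var i = (λ xs → lookup xs i) , P i , λ xs → eP

zeroC : ∀ {n} → CFun n
zeroC = (λ _ → 0) , Z , λ xs → eZ

sucC : ∀ {n} → CFun n → CFun n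
sucC e = app ((λ { (x ∷ []) → suc x }) , S , λ { (x ∷ []) → eS }) (e ∷ [])

lit : ∀ {n} → ℕ → CFun n
lit zero = zeroC
lit (suc k) = sucC (lit k)

ap₁ : ∀ {n} → CFun 1 → CFun n → CFun n
ap₁ c e = app c (e ∷ [])

ap₂ : ∀ {n} → CFun 2 → CFun n → CFun n → CFun n
ap₂ c e f = app c (e ∷ f ∷ [])

ap₃ : ∀ {n} → CFun 3 → CFun n → CFun n → CFun n → CFun n
ap₃ c e f g = app c (e ∷ f ∷ g ∷ [])

iter : (ℕ → ℕ → ℕ) → ℕ → ℕ → ℕ
iter s b zero = b
iter s b (suc k) = s k (iter s b k)

recC : ∀ {n} → CFun n → CFun (suc (suc n)) → CFun (suc n)
recC {n} (b , cb , eb) (s , cs , es) =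
  (λ { (k ∷ xs) → iter (λ j r → s (j ∷ r ∷ xs)) (b xs) k }) , R cb cs , λ { (k ∷ xs) → run k xs }
  where
  run : ∀ k xs → Eval (R cb cs) (k ∷ xs) (iter (λ j r → s (j ∷ r ∷ xs)) (b xs) k)
  run zero xs = eR0 (eb xs)
  run (suc k) xs = eRs (run k xs) (es _)

-- A program for f may compute it in a different syntactic form: any
-- computable function extensionally equal to g makes g computable.
respec : ∀ {n} (g : Fn n) (c : CFun n) → (∀ xs → ⟦ c ⟧ xs ≡ g xs) → CFun n
respec g (f , c , e) eq = g , c , λ xs → subst (Eval c xs) (eq xs) (e xs)

implement₁ : (f : ℕ → ℕ) (c : CFun 1) → (∀ x → ⟦ c ⟧ (x ∷ []) ≡ f x) → CFun 1
implement₁ f c e = respec (λ { (x ∷ []) → f x }) c (λ { (x ∷ []) → e x })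

implement₂ : (f : ℕ → ℕ → ℕ) (c : CFun 2) → (∀ x y → ⟦ c ⟧ (x ∷ y ∷ []) ≡ f x y) → CFun 2
implement₂ f c e = respec (λ { (x ∷ y ∷ []) → f x y }) c (λ { (x ∷ y ∷ []) → e x y })

implement₃ : (f : ℕ → ℕ → ℕ → ℕ) (c : CFun 3) →
             (∀ x y z → ⟦ c ⟧ (x ∷ y ∷ z ∷ []) ≡ f x y z) → CFun 3
implement₃ f c e = respec (λ { (x ∷ y ∷ z ∷ []) → f x y z }) c (λ { (x ∷ y ∷ z ∷ []) → e x y z })

trailing : ∀ m n → Vec (CFun (m + n)) n
trailing m n = tabulate (λ i → var (m ↑ʳ i))

trailing-values : ∀ {m n} (ys : Vec ℕ m) (xs : Vec ℕ n) →
                  map (λ g → ⟦ g ⟧ (ys ++ xs)) (trailing m n) ≡ xs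
trailing-values {m} ys xs = begin
    map (λ g → ⟦ g ⟧ (ys ++ xs)) (tabulate (λ i → var (m ↑ʳ i)))
  ≡⟨ tabulate-∘ _ _ ⟨
    tabulate (λ i → lookup (ys ++ xs) (m ↑ʳ i))
  ≡⟨ tabulate-cong (lookup-++ʳ ys xs) ⟩
    tabulate (lookup xs)
  ≡⟨ tabulate∘lookup xs ⟩
    xs
  ∎
  where open ≡-Reasoning

ifz : ℕ → ℕ → ℕ → ℕ
ifz zero a b = a
ifz (suc _) a b = b

ifz-zero : ∀ {c} a b → c ≡ 0 → ifz c a b ≡ a
ifz-zero a b refl = refl

ifz-one : ∀ {c} a b → c ≡ 1 → ifz c a b ≡ b
ifz-one a b refl = refl

predC : CFun 1
predC = implement₁ pred (recC zeroC (var (# 0))) λ { zero → refl ; (suc x) → refl }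

addC : CFun 2
addC = implement₂ _+_ (recC (var (# 0)) (sucC (var (# 1)))) iterates-suc
  where
  iterates-suc : ∀ x y → iter (λ _ r → suc r) y x ≡ x + y
  iterates-suc zero y = refl
  iterates-suc (suc x) y = cong suc (iterates-suc x y)

monusC : CFun 2
monusC = implement₂ _∸_ (app (recC (var (# 0)) (ap₁ predC (var (# 1)))) (var (# 1) ∷ var (# 0) ∷ []))
  iterates-pred
  where
  iterates-pred : ∀ x y → iter (λ _ r → pred r) x y ≡ x ∸ y
  iterates-pred x zero = refl
  iterates-pred x (suc y) = trans (cong pred (iterates-pred x y)) (pred[m∸n]≡m∸[1+n] x y)

ifzC : CFun 3
ifzC = implement₃ ifz (recC (var (# 0)) (var (# 3))) λ { zero y z → refl ; (suc x) y z → refl }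

minC : CFun 2
minC = implement₂ _⊓_ (ap₂ monusC (var (# 0)) (ap₂ monusC (var (# 0)) (var (# 1)))) truncates
  where
  truncates : ∀ a b → a ∸ (a ∸ b) ≡ a ⊓ b
  truncates a b = begin
      a ∸ (a ∸ b)
    ≡⟨ cong (_∸ (a ∸ b)) (m⊓n+n∸m≡n b a) ⟨
      b ⊓ a + (a ∸ b) ∸ (a ∸ b)
    ≡⟨ m+n∸n≡m (b ⊓ a) (a ∸ b) ⟩
      b ⊓ a
    ≡⟨ ⊓-comm b a ⟩
      a ⊓ b
    ∎
    where open ≡-Reasoning

∸-suc : ∀ {n i} → i < n → n ∸ i ≡ suc (n ∸ suc i)
∸-suc {n} lt = +-∸-assoc 1 lt

-- Cantor pairing and its computable inverse.  The diagonal of z is the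
-- largest d with tri d ≤ z; then z = pair (d ∸ b) b with b = z ∸ tri d.

triC : CFun 1
triC = implement₁ tri (recC zeroC (ap₂ addC (sucC (var (# 0))) (var (# 1)))) unfolds
  where
  unfolds : ∀ x → iter (λ k r → suc k + r) 0 x ≡ tri x
  unfolds zero = refl
  unfolds (suc x) = cong (suc x +_) (unfolds x)

pairC : CFun 2
pairC = implement₂ pair (ap₂ addC (ap₁ triC (ap₂ addC (var (# 0)) (var (# 1)))) (var (# 1))) λ x y → refl

-- computed by walking z upwards, bumping d whenever tri (d + 1) is reached
diagonal : ℕ → ℕ
diagonal zero = 0
diagonal (suc z) = ifz (tri (suc (diagonal z)) ∸ suc z) (suc (diagonal z)) (diagonal z)

diagonalC : CFun 1
diagonalC = implement₁ diagonal
  (recC zeroC (ap₃ ifzC (ap₂ monusC (ap₁ triC (sucC (var (# 1)))) (sucC (var (# 0))))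
                       (sucC (var (# 1))) (var (# 1))))
  unfolds
  where
  unfolds : ∀ x → iter (λ k d → ifz (tri (suc d) ∸ suc k) (suc d) d) 0 x ≡ diagonal x
  unfolds zero = refl
  unfolds (suc x) = cong (λ d → ifz (tri (suc d) ∸ suc x) (suc d) d) (unfolds x)

tri-mono : ∀ d e → d < e → tri (suc d) ≤ tri e
tri-mono d (suc e) (s≤s d≤e) with m≤n⇒m<n∨m≡n d≤e
... | inj₂ refl = ≤-refl
... | inj₁ d<e = ≤-trans (tri-mono d e d<e) (m≤n+m (tri e) (suc e))

diagonal-bounds : ∀ z → tri (diagonal z) ≤ z × z < tri (suc (diagonal z))
diagonal-bounds zero = z≤n , s≤s z≤n
diagonal-bounds (suc z) with diagonal-bounds z | tri (suc (diagonal z)) ∸ suc z in eq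
... | (lo , hi) | zero = reached , below-next
  where
  reached : tri (suc (diagonal z)) ≤ suc z
  reached = m∸n≡0⇒m≤n eq
  below-next : suc z < tri (suc (suc (diagonal z)))
  below-next = subst (λ w → suc z < suc (suc (diagonal z)) + w) (≤-antisym hi reached)
                 (m<n+m (suc z) {suc (suc (diagonal z))} (s≤s z≤n))
... | (lo , hi) | suc _ = ≤-trans lo (n≤1+n z) , m∸n≢0⇒n<m (λ e → 0≢1+n (trans (sym e) eq))

diagonal-unique : ∀ d z → tri d ≤ z → z < tri (suc d) → diagonal z ≡ d
diagonal-unique d z lo hi with <-cmp (diagonal z) d | diagonal-bounds z
... | tri≈ _ e _ | _ = e
... | tri< lt _ _ | (_ , hi′) = ⊥-elim (<-irrefl refl (<-≤-trans hi′ (≤-trans (tri-mono _ d lt) lo)))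
... | tri> _ _ gt | (lo′ , _) = ⊥-elim (<-irrefl refl (<-≤-trans hi (≤-trans (tri-mono d _ gt) lo′)))

diagonal-pair : ∀ a b → diagonal (pair a b) ≡ a + b
diagonal-pair a b = diagonal-unique (a + b) (pair a b) (m≤m+n (tri (a + b)) b)
  (subst (_< tri (suc (a + b))) (+-comm b (tri (a + b))) (+-monoˡ-< (tri (a + b)) (s≤s (m≤n+m b a))))

-- The projections are kept opaque: their normal forms grow exponentially
-- when nested, and besides their definition only π-pair is ever needed.
opaque
  π₂ : ℕ → ℕ
  π₂ z = z ∸ tri (diagonal z)

  π₁ : ℕ → ℕ
  π₁ z = diagonal z ∸ π₂ z

  π₂-def : ∀ z → π₂ z ≡ z ∸ tri (diagonal z)
  π₂-def z = refl

  π₁-def : ∀ z → π₁ z ≡ diagonal z ∸ π₂ z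
  π₁-def z = refl

  π₂-pair : ∀ a b → π₂ (pair a b) ≡ b
  π₂-pair a b rewrite diagonal-pair a b = m+n∸m≡n (tri (a + b)) b

  π₁-pair : ∀ a b → π₁ (pair a b) ≡ a
  π₁-pair a b rewrite π₂-pair a b | diagonal-pair a b = m+n∸n≡m a b

π₂C : CFun 1
π₂C = implement₁ π₂ (ap₂ monusC (var (# 0)) (ap₁ triC (ap₁ diagonalC (var (# 0))))) λ x → sym (π₂-def x)

π₁C : CFun 1
π₁C = implement₁ π₁ (ap₂ monusC (ap₁ diagonalC (var (# 0))) (ap₁ π₂C (var (# 0)))) λ x → sym (π₁-def x)

half : ℕ → ℕ
half zero = 0
half (suc zero) = 0
half (suc (suc k)) = suc (half k)

parity : ℕ → ℕ
parity j = j ∸ (half j + half j)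

half-even : ∀ i → half (i + i) ≡ i
half-even zero = refl
half-even (suc i) rewrite +-suc i i = cong suc (half-even i)

half-odd : ∀ i → half (suc (i + i)) ≡ i
half-odd zero = refl
half-odd (suc i) rewrite +-suc i i = cong suc (half-odd i)

even-or-odd : ∀ k → (Σ ℕ λ i → k ≡ i + i) ⊎ (Σ ℕ λ i → k ≡ suc (i + i))
even-or-odd zero = inj₁ (0 , refl)
even-or-odd (suc k) with even-or-odd k
... | inj₁ (i , e) = inj₂ (i , cong suc e)
... | inj₂ (i , e) = inj₁ (suc i , cong suc (trans e (sym (+-suc i i))))

by-parity : ∀ (Q : ℕ → Set) → (∀ i → Q (i + i)) → (∀ i → Q (suc (i + i))) → ∀ j → Q j
by-parity Q even odd j with even-or-odd j
... | inj₁ (i , refl) = even i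
... | inj₂ (i , refl) = odd i

parity-even : ∀ i → parity (i + i) ≡ 0
parity-even i rewrite half-even i = n∸n≡0 (i + i)

parity-odd : ∀ i → parity (suc (i + i)) ≡ 1
parity-odd i rewrite half-odd i = m+n∸n≡m 1 (i + i)

-- primitive-recursive form of half: half (k + 1) = half k + parity k
half-suc : ∀ k → half (suc k) ≡ half k + parity k
half-suc k with even-or-odd k
... | inj₁ (i , refl) rewrite half-odd i | half-even i = sym (trans (cong (i +_) (n∸n≡0 (i + i))) (+-identityʳ i))
... | inj₂ (i , refl) rewrite half-even i | half-odd i = trans (+-comm 1 i) (cong (i +_) (sym (m+n∸n≡m 1 (i + i))))

halfC : CFun 1
halfC = implement₁ half (recC zeroC (ap₂ addC (var (# 1)) (ap₂ monusC (var (# 0)) (ap₂ addC (var (# 1)) (var (# 1))))))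
  unfolds
  where
  unfolds : ∀ k → iter (λ j h → h + (j ∸ (h + h))) 0 k ≡ half k
  unfolds zero = refl
  unfolds (suc k) = trans (cong (λ h → h + (k ∸ (h + h))) (unfolds k)) (sym (half-suc k))

parityC : CFun 1
parityC = implement₁ parity (ap₂ monusC (var (# 0)) (ap₂ addC (ap₁ halfC (var (# 0))) (ap₁ halfC (var (# 0))))) λ x → refl

half+half≤ : ∀ K → half K + half K ≤ K
half+half≤ K with even-or-odd K
... | inj₁ (j , refl) rewrite half-even j = ≤-refl
... | inj₂ (j , refl) rewrite half-odd j = n≤1+n (j + j)

half-mono : ∀ a b → a ≤ b → half a ≤ half b
half-mono zero b le = z≤n
half-mono (suc zero) b le = z≤n
half-mono (suc (suc a)) (suc (suc b)) (s≤s (s≤s le)) = s≤s (half-mono a b le)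

odd<double : ∀ {i h} → i < h → suc (i + i) < h + h
odd<double {i} lt = ≤-trans (≤-reflexive (sym (cong suc (+-suc i i)))) (+-mono-≤ lt lt)

odd<double⁻¹ : ∀ {i h} → suc (i + i) < h + h → i < h
odd<double⁻¹ {i} {h} lt with i <? h
... | yes i<h = i<h
... | no i≮h = ⊥-elim (<-irrefl refl (<-≤-trans (<-trans (n<1+n (i + i)) lt) (+-mono-≤ (≮⇒≥ i≮h) (≮⇒≥ i≮h))))

join-even : ∀ p q i → join p q (i + i) ≡ p i
join-even p q zero = refl
join-even p q (suc i) rewrite +-suc i i = join-even (λ k → p (suc k)) (λ k → q (suc k)) i

join-odd : ∀ p q i → join p q (suc (i + i)) ≡ q i
join-odd p q zero = refl
join-odd p q (suc i) rewrite +-suc i i = join-odd (λ k → p (suc k)) (λ k → q (suc k)) i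

-- firstNZ f K is the first nonzero value among f 0, …, f K (0 if none).
-- It is how a finite stage of a search over an associate is observed.
firstNZ : (ℕ → ℕ) → ℕ → ℕ
firstNZ f zero = f 0
firstNZ f (suc K) = ifz (firstNZ f K) (f (suc K)) (firstNZ f K)

firstNZC : ∀ {n} → CFun (suc n) → CFun (suc n)
firstNZC {n} b = respec (λ { (K ∷ xs) → firstNZ (λ i → ⟦ b ⟧ (i ∷ xs)) K }) search
  λ { (K ∷ xs) → computes K xs }
  where
  search : CFun (suc n)
  search = recC (app b (zeroC ∷ trailing 0 n))
                (ap₃ ifzC (var (# 1)) (app b (sucC (var (# 0)) ∷ trailing 2 n)) (var (# 1)))
  computes : ∀ K xs → ⟦ search ⟧ (K ∷ xs) ≡ firstNZ (λ i → ⟦ b ⟧ (i ∷ xs)) K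
  computes zero xs = cong (λ v → ⟦ b ⟧ (0 ∷ v)) (trailing-values [] xs)
  computes (suc K) xs rewrite computes K xs
    | trailing-values (K ∷ firstNZ (λ i → ⟦ b ⟧ (i ∷ xs)) K ∷ []) xs = refl

firstNZ-cong : ∀ {f g : ℕ → ℕ} K → (∀ i → i ≤ K → f i ≡ g i) → firstNZ f K ≡ firstNZ g K
firstNZ-cong zero e = e 0 z≤n
firstNZ-cong {f} {g} (suc K) e
  rewrite firstNZ-cong {f} {g} K (λ i le → e i (m≤n⇒m≤1+n le)) | e (suc K) ≤-refl = refl

firstNZ-none : ∀ f K → (∀ j → j ≤ K → f j ≡ 0) → firstNZ f K ≡ 0
firstNZ-none f zero h = h 0 z≤n
firstNZ-none f (suc K) h rewrite firstNZ-none f K (λ j le → h j (m≤n⇒m≤1+n le)) = h (suc K) ≤-refl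

firstNZ-hit : ∀ f k₀ v → (∀ j → j < k₀ → f j ≡ 0) → f k₀ ≡ suc v → ∀ K → k₀ ≤ K → firstNZ f K ≡ suc v
firstNZ-hit f k₀ v h e zero z≤n = e
firstNZ-hit f k₀ v h e (suc K) le with m≤n⇒m<n∨m≡n le
... | inj₁ (s≤s k≤K) rewrite firstNZ-hit f k₀ v h e K k≤K = refl
... | inj₂ refl rewrite firstNZ-none f K (λ j j≤K → h j (s≤s j≤K)) = e

firstNZ-none⁻¹ : ∀ f K → firstNZ f K ≡ 0 → ∀ j → j ≤ K → f j ≡ 0
firstNZ-none⁻¹ f zero e .zero z≤n = e
firstNZ-none⁻¹ f (suc K) e j le with firstNZ f K in eq
firstNZ-none⁻¹ f (suc K) e j le | zero with m≤n⇒m<n∨m≡n le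
... | inj₁ (s≤s j≤K) = firstNZ-none⁻¹ f K eq j j≤K
... | inj₂ refl = e
firstNZ-none⁻¹ f (suc K) () j le | suc _

firstNZ-hit⁻¹ : ∀ f K v → firstNZ f K ≡ suc v →
                Σ ℕ λ k → k ≤ K × f k ≡ suc v × (∀ j → j < k → f j ≡ 0)
firstNZ-hit⁻¹ f zero v e = 0 , z≤n , e , λ j ()
firstNZ-hit⁻¹ f (suc K) v e with firstNZ f K in eq
... | zero = suc K , ≤-refl , e , λ j lt → firstNZ-none⁻¹ f K eq j (≤-pred lt)
... | suc w with firstNZ-hit⁻¹ f K w eq
...   | k , le , fk , z = k , m≤n⇒m≤1+n le , trans fk (cong suc (suc-injective e)) , z

-- Values in the image of shift are never 1, so 1 can serve as a marker
-- for "data missing" when a search runs on partial information.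
shift : ℕ → ℕ
shift x = ifz x 0 (suc x)

shiftC : CFun 1
shiftC = implement₁ shift (ap₃ ifzC (var (# 0)) zeroC (sucC (var (# 0)))) λ x → refl

shift≢1 : ∀ x → shift x ≢ 1
shift≢1 zero ()
shift≢1 (suc x) ()

firstNZ-shift : ∀ f K → firstNZ (λ k → shift (f k)) K ≡ shift (firstNZ f K)
firstNZ-shift f zero = refl
firstNZ-shift f (suc K) rewrite firstNZ-shift f K with firstNZ f K
... | zero = refl
... | suc _ = refl

firstNZ-partial : ∀ (f g : ℕ → ℕ) K → (∀ k → k ≤ K → g k ≡ f k ⊎ g k ≡ 1) → (∀ k → f k ≢ 1) →
                  firstNZ g K ≡ firstNZ f K ⊎ firstNZ g K ≡ 1
firstNZ-partial f g zero h f≢1 = h 0 z≤n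
firstNZ-partial f g (suc K) h f≢1 with firstNZ-partial f g K (λ k le → h k (m≤n⇒m≤1+n le)) f≢1
... | inj₂ e rewrite e = inj₂ refl
... | inj₁ e rewrite e with firstNZ f K
...   | zero = h (suc K) ≤-refl
...   | suc _ = inj₁ refl

Eventually : (ℕ → Set) → Set
Eventually Q = Σ ℕ λ B → ∀ K → B ≤ K → Q K

Unbounded : (ℕ → ℕ) → Set
Unbounded s = ∀ N → Eventually (λ K → N ≤ s K)

eventually-all : ∀ (Q : ℕ → ℕ → Set) N → (∀ i → i < N → Eventually (Q i)) →
                 Eventually (λ K → ∀ i → i < N → Q i K)
eventually-all Q zero h = 0 , λ K _ i ()
eventually-all Q (suc N) h with eventually-all Q N (λ i lt → h i (m≤n⇒m≤1+n lt)) | h N ≤-refl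
... | B , hB | B′ , hB′ = B ⊔ B′ , λ K le i i<1+N → case K le i i<1+N
  where
  case : ∀ K → B ⊔ B′ ≤ K → ∀ i → i < suc N → Q i K
  case K le i (s≤s i≤N) with m≤n⇒m<n∨m≡n i≤N
  ... | inj₁ i<N = hB K (≤-trans (m≤m⊔n B B′) le) i i<N
  ... | inj₂ refl = hB′ K (≤-trans (m≤n⊔m B B′) le)

bounded : ∀ (f : ℕ → ℕ) N → Σ ℕ λ B → ∀ k → k ≤ N → f k < B
bounded f zero = suc (f 0) , λ { .zero z≤n → ≤-refl }
bounded f (suc N) with bounded f N
... | B , h = B ⊔ suc (f (suc N)) , λ k le → case k le
  where
  case : ∀ k → k ≤ suc N → f k < B ⊔ suc (f (suc N))
  case k le with m≤n⇒m<n∨m≡n le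
  ... | inj₁ (s≤s k≤N) = ≤-trans (h k k≤N) (m≤m⊔n B _)
  ... | inj₂ refl = m≤n⊔m B _

-- The length of the initial run of nonzero values of g, capped at N: the
-- search marks each zero i of g by suc i.
zeroMark : (ℕ → ℕ) → ℕ → ℕ
zeroMark g i = ifz (g i) (suc i) 0

nonzeroRun : (ℕ → ℕ) → ℕ → ℕ
nonzeroRun g N = ifz (firstNZ (zeroMark g) N) N (pred (firstNZ (zeroMark g) N))

nonzeroRunC : ∀ {n} → CFun (suc n) → CFun (suc n)
nonzeroRunC {n} g = respec (λ { (N ∷ xs) → nonzeroRun (λ i → ⟦ g ⟧ (i ∷ xs)) N })
  (ap₃ ifzC firstZero (var (# 0)) (ap₁ predC firstZero)) λ { (N ∷ xs) → computes N xs }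
  where
  -- argument order (i , N , xs) for the search, (N , xs) outside
  firstZero : CFun (suc n)
  firstZero = app (firstNZC (ap₃ ifzC (app g (var (# 0) ∷ trailing 2 n)) (sucC (var (# 0))) zeroC))
                  (var (# 0) ∷ var (# 0) ∷ trailing 1 n)
  computes : ∀ N xs → ⟦ ap₃ ifzC firstZero (var (# 0)) (ap₁ predC firstZero) ⟧ (N ∷ xs) ≡
                      nonzeroRun (λ i → ⟦ g ⟧ (i ∷ xs)) N
  computes N xs rewrite trailing-values (N ∷ []) xs
    | firstNZ-cong {g = zeroMark (λ i → ⟦ g ⟧ (i ∷ xs))} N
        (λ i _ → cong (λ v → ifz (⟦ g ⟧ (i ∷ v)) (suc i) 0) (trailing-values (i ∷ N ∷ []) xs)) = refl

zeroMark≡0 : ∀ g i → zeroMark g i ≡ 0 → g i ≢ 0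
zeroMark≡0 g i e gi≡0 rewrite gi≡0 = 0≢1+n (sym e)

zeroMark≡suc : ∀ g i v → zeroMark g i ≡ suc v → g i ≡ 0 × v ≡ i
zeroMark≡suc g i v e with g i
... | zero = refl , sym (suc-injective e)
zeroMark≡suc g i v () | suc _

nonzeroRun-below : ∀ g N i → i < nonzeroRun g N → g i ≢ 0
nonzeroRun-below g N i lt with firstNZ (zeroMark g) N in eq
... | zero = zeroMark≡0 g i (firstNZ-none⁻¹ (zeroMark g) N eq i (<⇒≤ lt))
... | suc v with firstNZ-hit⁻¹ (zeroMark g) N v eq
...   | k , _ , hit , before with zeroMark≡suc g k v hit
...     | _ , refl = zeroMark≡0 g i (before i lt)

nonzeroRun-≥ : ∀ g N N′ → N′ ≤ N → (∀ i → i < N′ → g i ≢ 0) → N′ ≤ nonzeroRun g N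
nonzeroRun-≥ g N N′ le nonzero with firstNZ (zeroMark g) N in eq
... | zero = le
... | suc v with firstNZ-hit⁻¹ (zeroMark g) N v eq
...   | k , _ , hit , _ with zeroMark≡suc g k v hit
...     | gk≡0 , refl with N′ ≤? k
...       | yes ok = ok
...       | no nle = ⊥-elim (nonzero k (≰⇒> nle) gk≡0)

pcode : (ℕ → ℕ) → ℕ → ℕ
pcode f n = code (prefix f n)

hd : ℕ → ℕ
hd c = π₁ (pred c)

tl : ℕ → ℕ
tl c = π₂ (pred c)

dropCode : ℕ → ℕ → ℕ
dropCode c i = iter (λ _ r → tl r) c i

nth : ℕ → ℕ → ℕ
nth c i = hd (dropCode c i)

-- the first i at which dropping i entries leaves the empty code
-- (searching up to c suffices, as the length never exceeds the code)
len : ℕ → ℕ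
len c = pred (firstNZ (zeroMark (dropCode c)) c)

take : ℕ → ℕ → ℕ
take c k = pcode (nth c) k

pcode-suc : ∀ f n → pcode f (suc n) ≡ suc (pair (f 0) (pcode (λ i → f (suc i)) n))
pcode-suc f n = cong code (prefix-suc f n)
  where
  prefix-suc : ∀ f n → prefix f (suc n) ≡ f 0 ∷ prefix (λ i → f (suc i)) n
  prefix-suc f zero = refl
  prefix-suc f (suc n) rewrite prefix-suc f n = refl

pcode-cong : ∀ {f g : ℕ → ℕ} n → (∀ i → i < n → f i ≡ g i) → pcode f n ≡ pcode g n
pcode-cong zero e = refl
pcode-cong {f} {g} (suc n) e rewrite pcode-suc f n | pcode-suc g n | e 0 (s≤s z≤n)
  | pcode-cong {λ i → f (suc i)} {λ i → g (suc i)} n (λ i lt → e (suc i) (s≤s lt)) = refl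

hd-pcode : ∀ f n → hd (pcode f (suc n)) ≡ f 0
hd-pcode f n rewrite pcode-suc f n = π₁-pair (f 0) (pcode (λ i → f (suc i)) n)

tl-pcode : ∀ f n → tl (pcode f (suc n)) ≡ pcode (λ i → f (suc i)) n
tl-pcode f n rewrite pcode-suc f n = π₂-pair (f 0) (pcode (λ i → f (suc i)) n)

dropCode-pcode : ∀ f n i → i ≤ n → dropCode (pcode f n) i ≡ pcode (λ j → f (i + j)) (n ∸ i)
dropCode-pcode f n zero le = refl
dropCode-pcode f n (suc i) le = begin
    tl (dropCode (pcode f n) i)
  ≡⟨ cong tl (dropCode-pcode f n i (≤-trans (n≤1+n i) le)) ⟩
    tl (pcode (λ j → f (i + j)) (n ∸ i))
  ≡⟨ cong (λ m → tl (pcode (λ j → f (i + j)) m)) (∸-suc le) ⟩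
    tl (pcode (λ j → f (i + j)) (suc (n ∸ suc i)))
  ≡⟨ tl-pcode (λ j → f (i + j)) (n ∸ suc i) ⟩
    pcode (λ j → f (i + suc j)) (n ∸ suc i)
  ≡⟨ pcode-cong (n ∸ suc i) (λ j _ → cong f (+-suc i j)) ⟩
    pcode (λ j → f (suc i + j)) (n ∸ suc i)
  ∎
  where open ≡-Reasoning

nth-pcode : ∀ f n i → i < n → nth (pcode f n) i ≡ f i
nth-pcode f n i lt = begin
    hd (dropCode (pcode f n) i)
  ≡⟨ cong hd (dropCode-pcode f n i (<⇒≤ lt)) ⟩
    hd (pcode (λ j → f (i + j)) (n ∸ i))
  ≡⟨ cong (λ m → hd (pcode (λ j → f (i + j)) m)) (∸-suc lt) ⟩
    hd (pcode (λ j → f (i + j)) (suc (n ∸ suc i)))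
  ≡⟨ hd-pcode (λ j → f (i + j)) (n ∸ suc i) ⟩
    f (i + 0)
  ≡⟨ cong f (+-identityʳ i) ⟩
    f i
  ∎
  where open ≡-Reasoning

length≤pcode : ∀ f n → n ≤ pcode f n
length≤pcode f zero = z≤n
length≤pcode f (suc n) rewrite pcode-suc f n =
  s≤s (≤-trans (length≤pcode (λ i → f (suc i)) n) (m≤n+m _ (tri (f 0 + _))))

len-pcode : ∀ f n → len (pcode f n) ≡ n
len-pcode f n = cong pred (firstNZ-hit _ n n nonempty-before empty-at (pcode f n) (length≤pcode f n))
  where
  nonempty-before : ∀ j → j < n → zeroMark (dropCode (pcode f n)) j ≡ 0
  nonempty-before j lt rewrite dropCode-pcode f n j (<⇒≤ lt) | ∸-suc lt
    | pcode-suc (λ k → f (j + k)) (n ∸ suc j) = refl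
  empty-at : zeroMark (dropCode (pcode f n)) n ≡ suc n
  empty-at rewrite dropCode-pcode f n n ≤-refl | n∸n≡0 n = refl

take-pcode : ∀ f n k → k ≤ n → take (pcode f n) k ≡ pcode f k
take-pcode f n k le = pcode-cong k (λ i lt → nth-pcode f n i (<-≤-trans lt le))

-- The code of [f (L ∸ j), …, f (L ∸ 1)], built by recursion on j: codes
-- of prefixes are computed from the end.
fromEnd : (ℕ → ℕ) → ℕ → ℕ → ℕ
fromEnd f L zero = 0
fromEnd f L (suc j) = suc (pair (f (L ∸ suc j)) (fromEnd f L j))

fromEnd-pcode : ∀ f L j → j ≤ L → fromEnd f L j ≡ pcode (λ i → f (L ∸ j + i)) j
fromEnd-pcode f L zero le = refl
fromEnd-pcode f L (suc j) le = begin
    suc (pair (f (L ∸ suc j)) (fromEnd f L j))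
  ≡⟨ cong (λ w → suc (pair (f (L ∸ suc j)) w)) (fromEnd-pcode f L j (≤-trans (n≤1+n j) le)) ⟩
    suc (pair (f (L ∸ suc j)) (pcode (λ i → f (L ∸ j + i)) j))
  ≡⟨ cong₂ (λ a b → suc (pair a b)) (cong f (sym (+-identityʳ (L ∸ suc j))))
       (pcode-cong j (λ i _ → cong f (trans (cong (_+ i) (∸-suc le)) (sym (+-suc (L ∸ suc j) i))))) ⟩
    suc (pair (f (L ∸ suc j + 0)) (pcode (λ i → f (L ∸ suc j + suc i)) j))
  ≡⟨ pcode-suc (λ i → f (L ∸ suc j + i)) j ⟨
    pcode (λ i → f (L ∸ suc j + i)) (suc j)
  ∎
  where open ≡-Reasoning

pcodeC : ∀ {n} → CFun (suc n) → CFun (suc n)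
pcodeC {n} b = respec (λ { (L ∷ xs) → pcode (λ i → ⟦ b ⟧ (i ∷ xs)) L }) tabulation
  λ { (L ∷ xs) → computes L xs }
  where
  step : CFun (suc (suc (suc n)))  -- arguments j , r , L , xs
  step = sucC (ap₂ pairC (app b (ap₂ monusC (var (# 2)) (sucC (var (# 0))) ∷ trailing 3 n)) (var (# 1)))
  tabulation : CFun (suc n)
  tabulation = app (recC zeroC step) (var (# 0) ∷ var (# 0) ∷ trailing 1 n)
  computes : ∀ L xs → ⟦ tabulation ⟧ (L ∷ xs) ≡ pcode (λ i → ⟦ b ⟧ (i ∷ xs)) L
  computes L xs rewrite trailing-values (L ∷ []) xs = begin
      ⟦ recC zeroC step ⟧ (L ∷ L ∷ xs)
    ≡⟨ steps L ⟩
      fromEnd f L L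
    ≡⟨ fromEnd-pcode f L L ≤-refl ⟩
      pcode (λ i → f (L ∸ L + i)) L
    ≡⟨ pcode-cong L (λ i _ → cong (λ m → f (m + i)) (n∸n≡0 L)) ⟩
      pcode f L
    ∎
    where
    open ≡-Reasoning
    f : ℕ → ℕ
    f i = ⟦ b ⟧ (i ∷ xs)
    steps : ∀ k → ⟦ recC zeroC step ⟧ (k ∷ L ∷ xs) ≡ fromEnd f L k
    steps zero = refl
    steps (suc k) rewrite steps k | trailing-values (k ∷ fromEnd f L k ∷ L ∷ []) xs = refl

hdC : CFun 1
hdC = implement₁ hd (ap₁ π₁C (ap₁ predC (var (# 0)))) λ x → refl

tlC : CFun 1
tlC = implement₁ tl (ap₁ π₂C (ap₁ predC (var (# 0)))) λ x → refl

dropCodeC : CFun 2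
dropCodeC = implement₂ dropCode (app (recC (var (# 0)) (ap₁ tlC (var (# 1)))) (var (# 1) ∷ var (# 0) ∷ [])) λ x y → refl

nthC : CFun 2
nthC = implement₂ nth (ap₁ hdC (ap₂ dropCodeC (var (# 0)) (var (# 1)))) λ x y → refl

lenC : CFun 1
lenC = implement₁ len (ap₁ predC (app (firstNZC (ap₃ ifzC (ap₂ dropCodeC (var (# 1)) (var (# 0))) (sucC (var (# 0))) zeroC))
                                      (var (# 0) ∷ var (# 0) ∷ []))) λ x → refl

takeC : CFun 2
takeC = implement₂ take (app (pcodeC (ap₂ nthC (var (# 1)) (var (# 0)))) (var (# 1) ∷ var (# 0) ∷ [])) λ x y → refl

-- An associate answers "no answer yet" (0) or "output m" (suc m).
-- Stage K of the computation of output n of F_q on p is the first answer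
-- q gives on the prefixes of p of length at most K; g ⇝ t says that such
-- stage-indexed answers converge to output t.
_⇝_ : (ℕ → ℕ) → ℕ → Set
g ⇝ t = (∀ K → g K ≡ 0 ⊎ g K ≡ suc t) × Eventually (λ K → g K ≡ suc t)

⇝-ext : ∀ {g h t} → (∀ K → g K ≡ h K) → g ⇝ t → h ⇝ t
⇝-ext {t = t} e (stable , B , conv) =
  (λ K → subst (λ v → v ≡ 0 ⊎ v ≡ suc t) (e K) (stable K)) , B , λ K le → trans (sym (e K)) (conv K le)

⇝-reindex : ∀ {g t} (s : ℕ → ℕ) → g ⇝ t → Unbounded s → (λ K → g (s K)) ⇝ t
⇝-reindex s (stable , B , conv) s-unbounded with s-unbounded B
... | B′ , hB′ = (λ K → stable (s K)) , B′ , λ K le → conv (s K) (hB′ K le)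

assoc⇒⇝ : ∀ (q p : Baire) n v → AssocOut q p n v → (λ K → firstNZ (λ k → q (pair n (pcode p k))) K) ⇝ v
assoc⇒⇝ q p n v (k₀ , hit , before) = stable , k₀ , firstNZ-hit _ k₀ v before hit
  where
  stable : ∀ K → _ ≡ 0 ⊎ _ ≡ suc v
  stable K with k₀ ≤? K
  ... | yes le = inj₂ (firstNZ-hit _ k₀ v before hit K le)
  ... | no nle = inj₁ (firstNZ-none _ K (λ j j≤K → before j (≤-<-trans j≤K (≰⇒> nle))))

⇝⇒assoc : ∀ (q p : Baire) n t (g : ℕ → ℕ) → (∀ K → q (pair n (pcode p K)) ≡ g K) → g ⇝ t → AssocOut q p n t
⇝⇒assoc q p n t g e (stable , B , conv) with firstNZ g B in eq
... | zero = ⊥-elim (0≢1+n (trans (sym (firstNZ-none⁻¹ g B eq B ≤-refl)) (conv B ≤-refl)))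
... | suc v with firstNZ-hit⁻¹ g B v eq
...   | k , _ , gk , before with stable k
...     | inj₁ gk≡0 = ⊥-elim (0≢1+n (trans (sym gk≡0) gk))
...     | inj₂ gk≡t = k , trans (e k) gk≡t , λ j lt → trans (e j) (before j lt)

assoc-ext : ∀ {q q′ : Baire} → (∀ i → q i ≡ q′ i) → ∀ p r → Assoc q p r → Assoc q′ p r
assoc-ext e p r a n with a n
... | k , hit , before = k , trans (sym (e _)) hit , λ j lt → trans (sym (e _)) (before j lt)

-- the stage reached by associate a at output n when only the prefix with
-- code c of the input is known
runOn : Baire → ℕ → ℕ → ℕ
runOn a c n = firstNZ (λ k → a (pair n (take c k))) (len c)

runOn-pcode : ∀ a p K n → runOn a (pcode p K) n ≡ firstNZ (λ k → a (pair n (pcode p k))) K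
runOn-pcode a p K n rewrite len-pcode p K =
  firstNZ-cong K (λ k le → cong (λ c → a (pair n c)) (take-pcode p K k le))

runOnC : (a : Baire) → Computable a → CFun 2
runOnC a (ca , ea) = implement₂ (runOn a)
  (app (firstNZC (ap₁ A (ap₂ pairC (var (# 2)) (ap₂ takeC (var (# 1)) (var (# 0))))))
       (ap₁ lenC (var (# 0)) ∷ var (# 0) ∷ var (# 1) ∷ [])) λ x y → refl
  where
  A : CFun 1
  A = (λ { (x ∷ []) → a x }) , ca , λ { (x ∷ []) → ea x }

-- Partial data: an entry is 1 ("missing") or shift v ("known to be v").
-- entry u i reads an associate of which only the list with code u is known.
entry : ℕ → ℕ → ℕ
entry u i = ifz (suc i ∸ len u) (shift (nth u i)) 1

entryC : CFun 2
entryC = implement₂ entry (ap₃ ifzC (ap₂ monusC (sucC (var (# 1))) (ap₁ lenC (var (# 0))))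
                                   (ap₁ shiftC (ap₂ nthC (var (# 0)) (var (# 1)))) (lit 1)) λ x y → refl

entry-pcode : ∀ d L i → entry (pcode d L) i ≡ shift (d i) ⊎ entry (pcode d L) i ≡ 1
entry-pcode d L i rewrite len-pcode d L with suc i ∸ L in eq
... | zero = inj₁ (cong shift (nth-pcode d L i (m∸n≡0⇒m≤n eq)))
... | suc _ = inj₂ refl

entry-pcode< : ∀ d L i → i < L → entry (pcode d L) i ≡ shift (d i)
entry-pcode< d L i lt rewrite len-pcode d L | m≤n⇒m∸n≡0 lt = cong shift (nth-pcode d L i lt)

-- runOn for an associate known only partially: shift of the true stage,
-- or 1 when the run needed a missing entry
runPartial : ℕ → ℕ → ℕ → ℕ
runPartial u c b = firstNZ (λ k → entry u (pair b (take c k))) (len c)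

runPartialC : CFun 3
runPartialC = implement₃ runPartial
  (app (firstNZC (ap₂ entryC (var (# 1)) (ap₂ pairC (var (# 3)) (ap₂ takeC (var (# 2)) (var (# 0))))))
       (ap₁ lenC (var (# 1)) ∷ var (# 0) ∷ var (# 1) ∷ var (# 2) ∷ [])) λ x y z → refl

runPartial-pcode : ∀ d L c b → runPartial (pcode d L) c b ≡ shift (runOn d c b) ⊎ runPartial (pcode d L) c b ≡ 1
runPartial-pcode d L c b rewrite sym (firstNZ-shift (λ k → d (pair b (take c k))) (len c)) =
  firstNZ-partial _ _ (len c) (λ k _ → entry-pcode d L _) (λ k → shift≢1 _)

runPartial-complete : ∀ d c b → Eventually (λ L → runPartial (pcode d L) c b ≡ shift (runOn d c b))
runPartial-complete d c b with bounded (λ k → pair b (take c k)) (len c)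
... | B , below = B , λ L le → trans
  (firstNZ-cong (len c) (λ k k≤ → entry-pcode< d L _ (<-≤-trans (below k k≤) le)))
  (firstNZ-shift (λ k → d (pair b (take c k))) (len c))

-- Dependent conjunction in 𝕊: the open U ⊆ Y seen as an open subset of X
-- is x ↦ Y x ∧ U (x , _).
both : (b : Bool) → (T b → Bool) → Bool
both true g = g tt
both false g = false

both-intro : ∀ b (g : T b → Bool) (t : T b) → T (g t) → T (both b g)
both-intro true g t x = x

both-elim : ∀ b (g : T b → Bool) → T (both b g) → (t : T b) → T (g t)
both-elim true g x t = x

both-fst : ∀ b (g : T b → Bool) → T (both b g) → T b
both-fst true g x = tt

-- Stage-wise conjunction of two associate answers y, z: the output is 1
-- iff both outputs are nonzero.  A zero output of y decides without z.
conj : ℕ → ℕ → ℕ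
conj y z = ifz y 0 (ifz (pred y) 1 (ifz z 0 (ifz (pred z) 1 2)))

conjC : CFun 2
conjC = implement₂ conj
  (ap₃ ifzC (var (# 0)) zeroC (ap₃ ifzC (ap₁ predC (var (# 0))) (lit 1)
     (ap₃ ifzC (var (# 1)) zeroC (ap₃ ifzC (ap₁ predC (var (# 1))) (lit 1) (lit 2))))) λ x y → refl

conj-⇝-decided : ∀ (y z : ℕ → ℕ) → y ⇝ 0 → (λ K → conj (y K) (z K)) ⇝ 0
conj-⇝-decided y z (stable , B , conv) = stable′ , B , λ K le → cong (λ v → conj v (z K)) (conv K le)
  where
  stable′ : ∀ K → conj (y K) (z K) ≡ 0 ⊎ conj (y K) (z K) ≡ 1
  stable′ K with stable K
  ... | inj₁ e rewrite e = inj₁ refl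
  ... | inj₂ e rewrite e = inj₂ refl

conj-⇝ : ∀ (y z : ℕ → ℕ) s t → y ⇝ suc s → z ⇝ t → (λ K → conj (y K) (z K)) ⇝ ifz t 0 1
conj-⇝ y z s t (stableY , B , convY) (stableZ , B′ , convZ) =
  stable , B ⊔ B′ , λ K le → both-answered K (convY K (≤-trans (m≤m⊔n B B′) le)) (convZ K (≤-trans (m≤n⊔m B B′) le))
  where
  both-answered : ∀ K → y K ≡ suc (suc s) → z K ≡ suc t → conj (y K) (z K) ≡ suc (ifz t 0 1)
  both-answered K ey ez rewrite ey | ez = answered t
    where
    answered : ∀ t → conj (suc (suc s)) (suc t) ≡ suc (ifz t 0 1)
    answered zero = refl
    answered (suc _) = refl
  stable : ∀ K → conj (y K) (z K) ≡ 0 ⊎ conj (y K) (z K) ≡ suc (ifz t 0 1)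
  stable K with stableY K | stableZ K
  ... | inj₁ ey | _ rewrite ey = inj₁ refl
  ... | inj₂ ey | inj₁ ez rewrite ey | ez = inj₁ refl
  ... | inj₂ ey | inj₂ ez = inj₂ (both-answered K ey ez)

conj-realizes : ∀ (b : Bool) (g : T b → Bool) (rY : Baire) (ys zs : ℕ → ℕ → ℕ) →
  SName rY b → (∀ a → ys a ⇝ rY a) →
  ((t : T b) → Σ Baire λ rU → (∀ c → zs c ⇝ rU c) × SName rU (g t)) →
  Σ Baire λ rW → (∀ n → (λ K → conj (ys (π₁ n) K) (zs (π₂ n) K)) ⇝ rW n) × SName rW (both b g)
conj-realizes false g rY ys zs rY≡0 ys⇝ _ =
  (λ _ → 0) , (λ n → conj-⇝-decided (ys (π₁ n)) (zs (π₂ n)) (subst (ys (π₁ n) ⇝_) (rY≡0 (π₁ n)) (ys⇝ (π₁ n)))) , λ n → refl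
conj-realizes true g rY ys zs nameY ys⇝ named-g with named-g tt
... | rU , zs⇝ , nameU = rW , stages , name
  where
  rW : Baire
  rW n = ifz (rY (π₁ n)) 0 (ifz (rU (π₂ n)) 0 1)
  stages : ∀ n → (λ K → conj (ys (π₁ n) K) (zs (π₂ n) K)) ⇝ rW n
  stages n with rY (π₁ n) in eq
  ... | zero = conj-⇝-decided (ys (π₁ n)) (zs (π₂ n)) (subst (ys (π₁ n) ⇝_) eq (ys⇝ (π₁ n)))
  ... | suc s = conj-⇝ (ys (π₁ n)) (zs (π₂ n)) s (rU (π₂ n)) (subst (ys (π₁ n) ⇝_) eq (ys⇝ (π₁ n))) (zs⇝ (π₂ n))
  name : SName rW (g tt)
  name with g tt
  ... | true = witness nameY nameU
    where
    witness : SName rY true → SName rU true → SName rW true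
    witness (a , ya≢0) (c , uc≢0) = pair a c , nonzero
      where
      nonzero : rW (pair a c) ≢ 0
      nonzero rewrite π₁-pair a c | π₂-pair a c with rY a | rU c
      ... | zero | _ = λ _ → ya≢0 refl
      ... | suc _ | zero = λ _ → uc≢0 refl
      ... | suc _ | suc _ = λ ()
  ... | false = λ n → zero-everywhere n
    where
    zero-everywhere : ∀ n → rW n ≡ 0
    zero-everywhere n rewrite nameU (π₂ n) with rY (π₁ n)
    ... | zero = refl
    ... | suc _ = refl

lift : (X : Rep) (Y : Carrier X → Bool) → (Carrier (Sub X Y) → Bool) → Carrier X → Bool
lift X Y U x = both (Y x) (λ t → U (x , t))

-- Reading a partial search result z′ (1 = data missing): settle z′ v is
-- "no answer yet" if data was missing and v otherwise.
settle : ℕ → ℕ → ℕ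
settle z′ v = ifz z′ v (ifz (pred z′) 0 v)

settleC : CFun 2
settleC = implement₂ settle (ap₃ ifzC (var (# 0)) (var (# 1)) (ap₃ ifzC (ap₁ predC (var (# 0))) zeroC (var (# 1))))
  λ x y → refl

settle-shift : ∀ z v → settle (shift z) v ≡ v
settle-shift zero v = refl
settle-shift (suc z) v = refl

pred-shift : ∀ z → pred (shift z) ≡ z
pred-shift zero = refl
pred-shift (suc z) = refl

-- Given a name qY of Y, a name d of an open U of the subspace Y is turned
-- into the name restrict d of lift U in X: on index pair (pair a b) c it
-- runs qY at output a and d at output b on the input prefix coded by c
-- and takes the stage-wise conjunction.
module Restriction (qY : Baire) where

  restrict : Baire → Baire
  restrict d i = conj (runOn qY (π₂ i) (π₁ (π₁ i))) (runOn d (π₂ i) (π₂ (π₁ i)))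

  restrict-names : (X : Rep) (Y : Carrier X → Bool) → NameO X qY Y →
                   ∀ d U → NameO (Sub X Y) d U → NameO X (restrict d) (lift X Y U)
  restrict-names X Y nameY d U nameU p x px with nameY p x px
  ... | rY , qY-on-p , rY-names with conj-realizes (Y x) (λ t → U (x , t)) rY ys zs rY-names
                                        (λ a → assoc⇒⇝ qY p a (rY a) (qY-on-p a)) d-stages
    where
    ys zs : ℕ → ℕ → ℕ
    ys a K = firstNZ (λ k → qY (pair a (pcode p k))) K
    zs c K = firstNZ (λ k → d (pair c (pcode p k))) K
    -- p also names the point (x , t) of the subspace
    d-stages : (t : T (Y x)) → Σ Baire λ rU → (∀ c → zs c ⇝ rU c) × SName rU (U (x , t))
    d-stages t with nameU p (x , t) px
    ... | rU , d-on-p , rU-names = rU , (λ c → assoc⇒⇝ d p c (rU c) (d-on-p c)) , rU-names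
  ... | rW , stages , rW-names = rW , (λ n → ⇝⇒assoc (restrict d) p n (rW n) _ (at-stage n) (stages n)) , rW-names
    where
    at-stage : ∀ n K → restrict d (pair n (pcode p K)) ≡
      conj (firstNZ (λ k → qY (pair (π₁ n) (pcode p k))) K) (firstNZ (λ k → d (pair (π₂ n) (pcode p k))) K)
    at-stage n K rewrite π₁-pair n (pcode p K) | π₂-pair n (pcode p K)
      | runOn-pcode qY p K (π₁ n) | runOn-pcode d p K (π₂ n) = refl

  -- The same computation when only a finite list (code u) of d is known:
  -- 0 if a missing entry of d was needed, otherwise 1 + restrict d i.
  restrictStage : ℕ → ℕ → ℕ
  restrictStage y z′ = settle z′ (suc (conj y (pred z′)))

  restrictStage-shift : ∀ y z → restrictStage y (shift z) ≡ suc (conj y z)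
  restrictStage-shift y z = trans (settle-shift z _) (cong (λ w → suc (conj y w)) (pred-shift z))

  restrictPartial : ℕ → ℕ → ℕ
  restrictPartial u i = restrictStage (runOn qY (π₂ i) (π₁ (π₁ i))) (runPartial u (π₂ i) (π₂ (π₁ i)))

  restrictPartial-pcode : ∀ d L i → restrictPartial (pcode d L) i ≡ suc (restrict d i) ⊎ restrictPartial (pcode d L) i ≡ 0
  restrictPartial-pcode d L i with runPartial-pcode d L (π₂ i) (π₂ (π₁ i))
  ... | inj₁ e rewrite e = inj₁ (restrictStage-shift (runOn qY (π₂ i) (π₁ (π₁ i))) (runOn d (π₂ i) (π₂ (π₁ i))))
  ... | inj₂ e rewrite e = inj₂ refl

  restrictPartial-complete : ∀ d i → Eventually (λ L → restrictPartial (pcode d L) i ≡ suc (restrict d i))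
  restrictPartial-complete d i with runPartial-complete d (π₂ i) (π₂ (π₁ i))
  ... | B , complete = B , λ L le → trans (cong (restrictStage (runOn qY (π₂ i) (π₁ (π₁ i)))) (complete L le))
                                       (restrictStage-shift (runOn qY (π₂ i) (π₁ (π₁ i))) (runOn d (π₂ i) (π₂ (π₁ i))))

  -- the initial segment of restrict d determined by the list u
  knownLength : ℕ → ℕ
  knownLength u = nonzeroRun (restrictPartial u) (len u)

  knownCode : ℕ → ℕ
  knownCode u = pcode (λ i → pred (restrictPartial u i)) (knownLength u)

  knownCode-pcode : ∀ d L → knownCode (pcode d L) ≡ pcode (restrict d) (knownLength (pcode d L))
  knownCode-pcode d L = pcode-cong (knownLength (pcode d L)) known
    where
    known : ∀ i → i < knownLength (pcode d L) → pred (restrictPartial (pcode d L) i) ≡ restrict d i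
    known i lt with restrictPartial-pcode d L i
    ... | inj₁ e rewrite e = refl
    ... | inj₂ e = ⊥-elim (nonzeroRun-below (restrictPartial (pcode d L)) (len (pcode d L)) i lt e)

  knownLength-unbounded : ∀ d → Unbounded (λ L → knownLength (pcode d L))
  knownLength-unbounded d N with eventually-all (λ i L → restrictPartial (pcode d L) i ≡ suc (restrict d i)) N
                                   (λ i _ → restrictPartial-complete d i)
  ... | B , complete = B ⊔ N , λ L le → nonzeroRun-≥ (restrictPartial (pcode d L)) (len (pcode d L)) N
        (subst (N ≤_) (sym (len-pcode d L)) (≤-trans (m≤n⊔m B N) le))
        (λ i lt e → 0≢1+n (trans (sym e) (complete L (≤-trans (m≤m⊔n B N) le) i lt)))

-- An associate stage (0 = no answer, suc v = answer v) read as partial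
-- data (1 = missing, shift v = known v).
asData : ℕ → ℕ
asData e = ifz e 1 (shift (pred e))

asDataC : CFun 1
asDataC = implement₁ asData (ap₃ ifzC (var (# 0)) (lit 1) (ap₁ shiftC (ap₁ predC (var (# 0))))) λ x → refl

-- A bounded search over values f 0 … f N that are themselves only given
-- by stages: no answer while a needed value is missing, otherwise the
-- answer of the search.
settledSearch : (ℕ → ℕ) → ℕ → ℕ
settledSearch f N = settle (firstNZ (λ k → asData (f k)) N) (suc (pred (firstNZ (λ k → asData (f k)) N)))

settle-shift-suc : ∀ H → settle (shift H) (suc (pred (shift H))) ≡ suc H
settle-shift-suc H = trans (settle-shift H _) (cong suc (pred-shift H))

settledSearch-⇝ : ∀ (s : ℕ → ℕ → ℕ) (v : ℕ → ℕ) N → (∀ k → s k ⇝ v k) →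
                  (λ K → settledSearch (λ k → s k K) N) ⇝ firstNZ v N
settledSearch-⇝ s v N s⇝v = stable , proj₁ all-answered , λ K le → settled K (proj₂ all-answered K le)
  where
  all-answered : Eventually (λ K → ∀ k → k < suc N → s k K ≡ suc (v k))
  all-answered = eventually-all (λ k K → s k K ≡ suc (v k)) (suc N) (λ k _ → proj₂ (s⇝v k))
  found : ∀ K → firstNZ (λ k → asData (s k K)) N ≡ shift (firstNZ v N) → settledSearch (λ k → s k K) N ≡ suc (firstNZ v N)
  found K e rewrite e = settle-shift-suc (firstNZ v N)
  settled : ∀ K → (∀ k → k < suc N → s k K ≡ suc (v k)) → settledSearch (λ k → s k K) N ≡ suc (firstNZ v N)
  settled K answered = found K (trans (firstNZ-cong N (λ k le → cong asData (answered k (s≤s le)))) (firstNZ-shift v N))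
  asData-stage : ∀ K k → asData (s k K) ≡ shift (v k) ⊎ asData (s k K) ≡ 1
  asData-stage K k with proj₁ (s⇝v k) K
  ... | inj₁ e rewrite e = inj₂ refl
  ... | inj₂ e rewrite e = inj₁ refl
  stable : ∀ K → settledSearch (λ k → s k K) N ≡ 0 ⊎ settledSearch (λ k → s k K) N ≡ suc (firstNZ v N)
  stable K with firstNZ-partial (λ k → shift (v k)) (λ k → asData (s k K)) N (λ k _ → asData-stage K k) (λ k → shift≢1 (v k))
  ... | inj₁ e = inj₂ (found K (trans e (firstNZ-shift v N)))
  ... | inj₂ e rewrite e = inj₁ refl

-- Its input is
-- join p d with p a name of x and d a name of U ⊆ Y in the subspace.
-- From a prefix w of that input it simulates the realizer qX of X on
-- join p (restrict d); the even outputs (the name of V) are passed on, the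
-- odd ones (the name of K) are obtained by precomposing the name odds r of
-- K with restrict, as a name of U′ ⊆ Y must be turned into a name of
-- lift U′ before K can be tested against it.
module Construction (qX qY : Baire) where
  open Restriction qY

  oddsCode : ℕ → ℕ
  oddsCode w = pcode (λ i → nth w (suc (i + i))) (half (len w))

  -- how many entries of p and of restrict d are available from w
  simLength : ℕ → ℕ
  simLength w = half (len w) ⊓ len (knownCode (oddsCode w))

  -- the available prefix of join p (restrict d)
  simInput : ℕ → ℕ
  simInput w = pcode (λ i → ifz (parity i) (nth w i) (nth (knownCode (oddsCode w)) (half i)))
                     (simLength w + simLength w)

  outerStage : ℕ → ℕ → ℕ
  outerStage w j = runOn qX (simInput w) j

  -- index t = pair n c asks for output n of odds r on restrict d′, where
  -- c codes a prefix of d′; the k-th query on it has index queryIndex t k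
  queryIndex : ℕ → ℕ → ℕ
  queryIndex t k = pair (π₁ t) (take (knownCode (π₂ t)) k)

  innerStage : ℕ → ℕ → ℕ
  innerStage w t = settledSearch (λ k → outerStage w (suc (queryIndex t k + queryIndex t k)))
                                 (len (knownCode (π₂ t)))

  stage : ℕ → ℕ → ℕ
  stage w j = ifz (parity j) (outerStage w j) (innerStage w (half j))

  qSub : Baire
  qSub z = stage (π₂ z) (π₁ z)

module ConstructionComputable (qX qY : Baire) (cX : Computable qX) (cY : Computable qY) where
  open Restriction qY
  open Construction qX qY

  restrictPartialC : CFun 2
  restrictPartialC = implement₂ restrictPartial
    (ap₂ settleC (ap₃ runPartialC (var (# 0)) (ap₁ π₂C (var (# 1))) (ap₁ π₂C (ap₁ π₁C (var (# 1)))))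
      (sucC (ap₂ conjC (ap₂ (runOnC qY cY) (ap₁ π₂C (var (# 1))) (ap₁ π₁C (ap₁ π₁C (var (# 1)))))
                       (ap₁ predC (ap₃ runPartialC (var (# 0)) (ap₁ π₂C (var (# 1))) (ap₁ π₂C (ap₁ π₁C (var (# 1))))))))) λ x y → refl

  knownLengthC : CFun 1
  knownLengthC = implement₁ knownLength
    (app (nonzeroRunC (ap₂ restrictPartialC (var (# 1)) (var (# 0)))) (ap₁ lenC (var (# 0)) ∷ var (# 0) ∷ [])) λ x → refl

  knownCodeC : CFun 1
  knownCodeC = implement₁ knownCode
    (app (pcodeC (ap₁ predC (ap₂ restrictPartialC (var (# 1)) (var (# 0))))) (ap₁ knownLengthC (var (# 0)) ∷ var (# 0) ∷ [])) λ x → refl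

  oddsCodeC : CFun 1
  oddsCodeC = implement₁ oddsCode
    (app (pcodeC (ap₂ nthC (var (# 1)) (sucC (ap₂ addC (var (# 0)) (var (# 0))))))
         (ap₁ halfC (ap₁ lenC (var (# 0))) ∷ var (# 0) ∷ [])) λ x → refl

  simLengthC : CFun 1
  simLengthC = implement₁ simLength
    (ap₂ minC (ap₁ halfC (ap₁ lenC (var (# 0)))) (ap₁ lenC (ap₁ knownCodeC (ap₁ oddsCodeC (var (# 0)))))) λ x → refl

  simInputC : CFun 1
  simInputC = implement₁ simInput
    (app (pcodeC (ap₃ ifzC (ap₁ parityC (var (# 0))) (ap₂ nthC (var (# 1)) (var (# 0)))
                          (ap₂ nthC (ap₁ knownCodeC (ap₁ oddsCodeC (var (# 1)))) (ap₁ halfC (var (# 0))))))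
         (ap₂ addC (ap₁ simLengthC (var (# 0))) (ap₁ simLengthC (var (# 0))) ∷ var (# 0) ∷ [])) λ x → refl

  outerStageC : CFun 2
  outerStageC = implement₂ outerStage (ap₂ (runOnC qX cX) (ap₁ simInputC (var (# 0))) (var (# 1))) λ x y → refl

  -- arguments k , t
  queryIndexC : CFun 2
  queryIndexC = implement₂ (λ k t → queryIndex t k)
    (ap₂ pairC (ap₁ π₁C (var (# 1))) (ap₂ takeC (ap₁ knownCodeC (ap₁ π₂C (var (# 1)))) (var (# 0)))) λ x y → refl

  -- the search of innerStage, argument order k , w , t
  searchC : CFun 2
  searchC = app (firstNZC (ap₁ asDataC (ap₂ outerStageC (var (# 1))
                  (sucC (ap₂ addC (ap₂ queryIndexC (var (# 0)) (var (# 2))) (ap₂ queryIndexC (var (# 0)) (var (# 2))))))))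
                (ap₁ lenC (ap₁ knownCodeC (ap₁ π₂C (var (# 1)))) ∷ var (# 0) ∷ var (# 1) ∷ [])

  innerStageC : CFun 2
  innerStageC = implement₂ innerStage (ap₂ settleC searchC (sucC (ap₁ predC searchC))) λ x y → refl

  stageC : CFun 2
  stageC = implement₂ stage
    (ap₃ ifzC (ap₁ parityC (var (# 1))) (ap₂ outerStageC (var (# 0)) (var (# 1))) (ap₂ innerStageC (var (# 0)) (ap₁ halfC (var (# 1))))) λ x y → refl

  qSubC : CFun 1
  qSubC = implement₁ qSub (ap₂ stageC (ap₁ π₂C (var (# 0))) (ap₁ π₁C (var (# 0)))) λ x → refl

  qSub-computable : Computable qSub
  qSub-computable = proj₁ (proj₂ qSubC) , λ z → proj₂ (proj₂ qSubC) (z ∷ [])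

-- The output of qSub as a function of the output r of qX: the even part
-- is kept, the odd part precomposes odds r with restrict.
module Output (qX qY r : Baire) where
  open Restriction qY
  open Construction qX qY

  -- output n of odds r on restrict d′, for t = pair n c with c coding a
  -- prefix of d′ (searching the part of restrict d′ that c determines)
  composed : ℕ → ℕ
  composed t = firstNZ (λ k → r (suc (queryIndex t k + queryIndex t k))) (len (knownCode (π₂ t)))

  r′ : Baire
  r′ j = ifz (parity j) (r j) (composed (half j))

  evens-r′ : ∀ i → evens r i ≡ evens r′ i
  evens-r′ i = cong (λ v → ifz v (r (i + i)) (composed (half (i + i)))) (sym (parity-even i))

  odds-r′ : ∀ i → odds r′ i ≡ composed i
  odds-r′ i rewrite parity-odd i | half-odd i = refl

  -- If evens r names an open V of X then evens r′ names V ∩ Y in the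
  -- subspace, which carries the same names of points.
  open-name : (X : Rep) (Y : Carrier X → Bool) (V : Carrier X → Bool) →
              NameO X (evens r) V → NameO (Sub X Y) (evens r′) (λ xy → V (proj₁ xy))
  open-name X Y V nameV p (x , _) px with nameV p x px
  ... | rV , outputs , rV-names = rV , assoc-ext evens-r′ p rV outputs , rV-names

  composed-pcode : ∀ d′ n L → composed (pair n (pcode d′ L)) ≡
                   firstNZ (λ k → odds r (pair n (pcode (restrict d′) k))) (knownLength (pcode d′ L))
  composed-pcode d′ n L rewrite π₁-pair n (pcode d′ L) | π₂-pair n (pcode d′ L) | knownCode-pcode d′ L
    | len-pcode (restrict d′) (knownLength (pcode d′ L)) =
    firstNZ-cong (knownLength (pcode d′ L)) (λ k le → cong (λ c → odds r (pair n c)) (take-pcode (restrict d′) _ k le))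

  -- If odds r names a compact K ⊆ Y of X then odds r′ names K in the
  -- subspace: testing K ⊆ U′ for U′ open in Y is testing K ⊆ lift U′.
  compact-name : (X : Rep) (Y : Carrier X → Bool) → NameO X qY Y → (K : Carrier X → Set) →
                 NameK X (odds r) K → (∀ x → K x → T (Y x)) → NameK (Sub X Y) (odds r′) (λ xy → K (proj₁ xy))
  compact-name X Y nameY K nameK K⊆Y d′ U′ nameU′ with nameK (restrict d′) (lift X Y U′) (restrict-names X Y nameY d′ U′ nameU′)
  ... | rK , outputs , b , rK-names , b⇔K⊆U′ = rK , outputs′ , b , rK-names , mk⇔ to from
    where
    outputs′ : Assoc (odds r′) d′ rK
    outputs′ n = ⇝⇒assoc (odds r′) d′ n (rK n) _ (λ L → trans (odds-r′ _) (composed-pcode d′ n L))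
      (⇝-reindex (λ L → knownLength (pcode d′ L)) (assoc⇒⇝ (odds r) (restrict d′) n (rK n) (outputs n))
                 (knownLength-unbounded d′))
    to : T b → ∀ xy → K (proj₁ xy) → T (U′ xy)
    to tb (x , t) kx = both-elim (Y x) (λ t → U′ (x , t)) (Equivalence.to b⇔K⊆U′ tb x kx) t
    from : (∀ xy → K (proj₁ xy) → T (U′ xy)) → T b
    from K⊆U′ = Equivalence.from b⇔K⊆U′ λ x kx → both-intro (Y x) (λ t → U′ (x , t)) (K⊆Y x kx) (K⊆U′ (x , K⊆Y x kx) kx)

-- If qX outputs r on join p (restrict d), then qSub outputs r′ on join p d:
-- along the prefixes of join p d, the simulated input is a prefix of
-- join p (restrict d) of unbounded length, so all stages converge.
module Simulation (qX qY p d r : Baire) (r-out : Assoc qX (join p (Restriction.restrict qY d)) r) where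
  open Restriction qY
  open Construction qX qY
  open Output qX qY r

  w : ℕ → ℕ
  w K = pcode (join p d) K

  -- lengths of the known prefixes of restrict d and of the simulated input
  known : ℕ → ℕ
  known K = knownLength (pcode d (half K))

  m : ℕ → ℕ
  m K = half K ⊓ known K

  oddsCode-w : ∀ K → oddsCode (w K) ≡ pcode d (half K)
  oddsCode-w K rewrite len-pcode (join p d) K = pcode-cong (half K) λ i lt →
    trans (nth-pcode (join p d) K (suc (i + i)) (<-≤-trans (odd<double lt) (half+half≤ K))) (join-odd p d i)

  knownCode-w : ∀ K → knownCode (oddsCode (w K)) ≡ pcode (restrict d) (known K)
  knownCode-w K rewrite oddsCode-w K = knownCode-pcode d (half K)

  simLength-w : ∀ K → simLength (w K) ≡ m K
  simLength-w K rewrite knownCode-w K | len-pcode (join p d) K | len-pcode (restrict d) (known K) = refl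

  simInput-w : ∀ K → simInput (w K) ≡ pcode (join p (restrict d)) (m K + m K)
  simInput-w K rewrite simLength-w K | knownCode-w K = pcode-cong (m K + m K) entries
    where
    entries : ∀ i → i < m K + m K →
              ifz (parity i) (nth (w K) i) (nth (pcode (restrict d) (known K)) (half i)) ≡ join p (restrict d) i
    entries i lt with even-or-odd i
    ... | inj₁ (j , refl) rewrite parity-even j =
      trans (nth-pcode (join p d) K (j + j)
               (<-≤-trans lt (≤-trans (+-mono-≤ (m⊓n≤m (half K) (known K)) (m⊓n≤m (half K) (known K))) (half+half≤ K))))
            (trans (join-even p d j) (sym (join-even p (restrict d) j)))
    ... | inj₂ (j , refl) rewrite parity-odd j | half-odd j =
      trans (nth-pcode (restrict d) (known K) j (<-≤-trans (odd<double⁻¹ lt) (m⊓n≤n (half K) (known K))))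
            (sym (join-odd p (restrict d) j))

  m-unbounded : Unbounded (λ K → m K + m K)
  m-unbounded N with knownLength-unbounded d N
  ... | B , enough = (B ⊔ N) + (B ⊔ N) , λ K le → ≤-trans (N≤m K le) (m≤m+n (m K) (m K))
    where
    half-large : ∀ K → (B ⊔ N) + (B ⊔ N) ≤ K → B ⊔ N ≤ half K
    half-large K le = subst (_≤ half K) (half-even (B ⊔ N)) (half-mono _ _ le)
    N≤m : ∀ K → (B ⊔ N) + (B ⊔ N) ≤ K → N ≤ m K
    N≤m K le = ⊓-glb (≤-trans (m≤n⊔m B N) (half-large K le))
                     (enough (half K) (≤-trans (m≤m⊔n B N) (half-large K le)))

  outerStage-⇝ : ∀ j → (λ K → outerStage (w K) j) ⇝ r j
  outerStage-⇝ j = ⇝-ext (λ K → sym (trans (cong (λ c → runOn qX c j) (simInput-w K))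
                                            (runOn-pcode qX (join p (restrict d)) (m K + m K) j)))
    (⇝-reindex (λ K → m K + m K) (assoc⇒⇝ qX (join p (restrict d)) j (r j) (r-out j)) m-unbounded)

  innerStage-⇝ : ∀ t → (λ K → innerStage (w K) t) ⇝ composed t
  innerStage-⇝ t = settledSearch-⇝ (λ k K → outerStage (w K) (suc (queryIndex t k + queryIndex t k)))
                     (λ k → r (suc (queryIndex t k + queryIndex t k))) (len (knownCode (π₂ t)))
                     (λ k → outerStage-⇝ (suc (queryIndex t k + queryIndex t k)))

  -- The parity case split is done through explicit equations: rewriting,
  -- or leaving the scrutinee of ifz to unification, would unfold stage.
  stage-even : ∀ i → (λ K → stage (w K) (i + i)) ⇝ r′ (i + i)
  stage-even i =
    ⇝-ext {g = λ K → outerStage (w K) (i + i)}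
          (λ K → sym (ifz-zero {parity (i + i)} (outerStage (w K) (i + i)) (innerStage (w K) (half (i + i))) (parity-even i)))
          (subst ((λ K → outerStage (w K) (i + i)) ⇝_)
                 (sym (ifz-zero {parity (i + i)} (r (i + i)) (composed (half (i + i))) (parity-even i)))
                 (outerStage-⇝ (i + i)))

  stage-odd : ∀ i → (λ K → stage (w K) (suc (i + i))) ⇝ r′ (suc (i + i))
  stage-odd i =
    ⇝-ext {g = λ K → innerStage (w K) i}
          (λ K → sym (trans (ifz-one {parity (suc (i + i))} (outerStage (w K) (suc (i + i)))
                                     (innerStage (w K) (half (suc (i + i)))) (parity-odd i))
                            (cong (innerStage (w K)) (half-odd i))))
          (subst ((λ K → innerStage (w K) i) ⇝_)
                 (sym (trans (ifz-one {parity (suc (i + i))} (r (suc (i + i))) (composed (half (suc (i + i)))) (parity-odd i))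
                             (cong composed (half-odd i))))
                 (innerStage-⇝ i))

  stage-⇝ : ∀ j → (λ K → stage (w K) j) ⇝ r′ j
  stage-⇝ = by-parity (λ j → (λ K → stage (w K) j) ⇝ r′ j) stage-even stage-odd

  qSub-outputs : Assoc qSub (join p d) r′
  qSub-outputs j = ⇝⇒assoc qSub (join p d) j (r′ j) (λ K → stage (w K) j) at-stage (stage-⇝ j)
    where
    at-stage : ∀ K → qSub (pair j (w K)) ≡ stage (w K) j
    at-stage K = cong₂ stage (π₂-pair j (w K)) (π₁-pair j (w K))

CompactBaseAt : (X : Rep) → Baire → Baire → Baire → Carrier X → (Carrier X → Bool) → Set₁
CompactBaseAt X q p₁ p₂ x U =
  Σ Baire λ r → Assoc q (join p₁ p₂) r ×
    Σ (Carrier X → Bool) λ V → Σ (Carrier X → Set) λ K →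
      NameO X (evens r) V × NameK X (odds r) K ×
      T (V x) × (∀ y → T (V y) → K y) × (∀ y → K y → T (U y))

CompactBase : (X : Rep) → Baire → Set₁
CompactBase X q = ∀ p₁ p₂ x U → δ X p₁ x → NameO X p₂ U → T (U x) → CompactBaseAt X q p₁ p₂ x U

-- An answer of X's realizer for x ∈ lift U yields the answer of qSub for
-- (x , _) ∈ U: V and K are intersected with Y.
restrict-answer : (X : Rep) (Y : Carrier X → Bool) (qX qY : Baire) → NameO X qY Y →
  ∀ p d x (x∈Y : T (Y x)) U → NameO (Sub X Y) d U →
  CompactBaseAt X qX p (Restriction.restrict qY d) x (lift X Y U) →
  CompactBaseAt (Sub X Y) (Construction.qSub qX qY) p d (x , x∈Y) U
restrict-answer X Y qX qY nameY p d x x∈Y U nameU (r , r-out , V , K , nameV , nameK , x∈V , V⊆K , K⊆U) =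
  r′ , qSub-outputs , (λ xy → V (proj₁ xy)) , (λ xy → K (proj₁ xy)) ,
  open-name X Y V nameV ,
  compact-name X Y nameY K nameK (λ y y∈K → both-fst (Y y) (λ t → U (y , t)) (K⊆U y y∈K)) ,
  x∈V , (λ xy → V⊆K (proj₁ xy)) ,
  (λ { (y , y∈Y) y∈K → both-elim (Y y) (λ t → U (y , t)) (K⊆U y y∈K) y∈Y })
  where
  open Output qX qY r
  open Simulation qX qY p d r r-out

subspace-compact-base : (X : Rep) (Y : Carrier X → Bool) (qX qY : Baire) → NameO X qY Y →
  CompactBase X qX → CompactBase (Sub X Y) (Construction.qSub qX qY)
subspace-compact-base X Y qX qY nameY realizerX p d (x , x∈Y) U px nameU x∈U =
  restrict-answer X Y qX qY nameY p d x x∈Y U nameU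
    (realizerX p (restrict d) x (lift X Y U) px (restrict-names X Y nameY d U nameU)
               (both-intro (Y x) (λ t → U (x , t)) x∈Y x∈U))
  where open Restriction qY

proposition3 : (X : Rep) (Y : Carrier X → Bool) →
    EffLocCompact X → ComputableOpen X Y → EffLocCompact (Sub X Y)
proposition3 X Y (qX , qX-computable , realizerX) (qY , qY-computable , nameY) =
  Construction.qSub qX qY ,
  ConstructionComputable.qSub-computable qX qY qX-computable qY-computable ,
  subspace-compact-base X Y qX qY nameY realizerX
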